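{- (i) Let $p,m,n\in\mathbb N$ and let $\{R_j\}_{j\in J}$ be a system of representatives of the right cosets in $\Gamma_0(nm,p)\backslash\Gamma_0(n,p)$. Then for distinct $j_1,j_2\in J$ we have $\Gamma_0(nm)R_{j_1}\cap\Gamma_0(nm)R_{j_2}=\emptyset$. (ii) Let $p$ be a prime with $p\mid n$, $e\in\mathbb N$, and let $\{R_j\}_{j\in J}$ be a system of representatives of the right cosets in $\Gamma_0(p^en,p)\backslash\Gamma_0(n,p)$, i.e. $\Gamma_0(n,p)=\bigsqcup_{j\in J}\Gamma_0(p^en,p)R_j$. Then $\{R_j\}_{j\in J}$ is already a system of representatives of the right cosets in $\Gamma_0(p^en)\backslash\Gamma_0(n)$.
   Context: $\Gamma_0(n)=\{\begin{pmatrix}a&b\\c&d\end{pmatrix}\in SL(2,\mathbb Z):n\mid c\}$; $\Gamma_0(n,m)=\{\begin{pmatrix}a&b\\c&d\end{pmatrix}\in SL(2,\mathbb Z):n\mid c,\ m\mid b\}$. -}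

module Defs where

open import Data.Nat using (ℕ)
open import Data.Integer using (ℤ; +_; _*_; _+_; _-_; 1ℤ)
open import Data.Integer.Divisibility using (_∣_)
open import Data.Product using (Σ; _×_; ∃)
open import Relation.Binary.PropositionalEquality using (_≡_; _≢_)
open import Relation.Nullary using (¬_)

-- 2×2 integer matrices (a b ; c d)
record Mat : Set where
  constructor mat
  field
    a b c d : ℤ
open Mat public

det : Mat → ℤ
det M = a M * d M - b M * c M

_·_ : Mat → Mat → Mat
M · N = mat (a M * a N + b M * c N) (a M * b N + b M * d N)
            (c M * a N + d M * c N) (c M * b N + d M * d N)

SL2 : Mat → Set
SL2 M = det M ≡ 1ℤ

Γ₀ : ℕ → Mat → Set
Γ₀ n M = SL2 M × ((+ n) ∣ c M)

Γ₀[_,_] : ℕ → ℕ → Mat → Set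
Γ₀[ n , m ] M = SL2 M × ((+ n) ∣ c M) × ((+ m) ∣ b M)

InRightCoset : (Mat → Set) → Mat → Mat → Set
InRightCoset H R g = Σ Mat (λ h → H h × g ≡ h · R)

IsRightCosetReps : (H G : Mat → Set) (J : Set) → (J → Mat) → Set
IsRightCosetReps H G J R =
  (∀ j → G (R j)) ×
  (∀ g → G g → Σ J (λ j → InRightCoset H (R j) g)) ×
  (∀ j₁ j₂ → j₁ ≢ j₂ → ∀ g → ¬ (InRightCoset H (R j₁) g × InRightCoset H (R j₂) g))

{-# OPTIONS --safe #-}

-- Γ₀(N,p) is the intersection of Γ₀(N) with the group Γ⁰(p) = {γ ∈ SL(2,ℤ) : p ∣ b}.
-- (i) If h₁R₁ = h₂R₂ with hᵢ ∈ Γ₀(N), then h₂⁻¹h₁ = R₂R₁⁻¹ lies in Γ₀(N) ∩ Γ⁰(p) = Γ₀(N,p),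
-- so R₁ and R₂ already share a Γ₀(N,p)-coset.
-- (ii) If p ∣ n and g = (a b ; c d) ∈ Γ₀(n), the shear t = (1 -ab ; 0 1), which lies in every
-- Γ₀(M), moves g into Γ₀(n,p): the upper right entry of tg is b - abd = b(1 - ad) = -b²c.
-- Hence Γ₀(n) = Γ₀(p^e n)·Γ₀(n,p), and the Γ₀(p^e n,p)-cosets of the Rⱼ lift to a cover of Γ₀(n).
module Submission where

open import Defs
open import Data.Nat using (ℕ; _*_; _^_; NonZero)
open import Data.Nat.Divisibility using (_∣_)
open import Data.Nat.Primality using (Prime)
open import Data.Product using (_×_)
open import Relation.Binary.PropositionalEquality using (_≢_)
open import Relation.Nullary using (¬_)

open import Data.Integer as ℤ using (ℤ; +_; -_; 1ℤ; 0ℤ)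
import Data.Integer.Divisibility as ℤ
import Data.Integer.Divisibility.Signed as Signed
open import Data.Integer.Tactic.RingSolver using (solve-∀)
import Data.Nat.Divisibility as ℕ
open import Data.Product using (Σ; _,_; proj₁; proj₂)
open import Relation.Binary.PropositionalEquality
  using (_≡_; refl; sym; trans; cong; cong₂; subst; module ≡-Reasoning)

-- Divisibility in Defs is unsigned (∣k∣ ∣ ∣m∣), so the signed library lemmas are
-- transported along ∣ᵤ⇒∣ and ∣⇒∣ᵤ, whose implicit arguments cannot be inferred.

∣m∣n⇒∣m+n : ∀ k m n → k ℤ.∣ m → k ℤ.∣ n → k ℤ.∣ m ℤ.+ n
∣m∣n⇒∣m+n k m n k∣m k∣n =
  Signed.∣⇒∣ᵤ {k} {m ℤ.+ n} (Signed.∣m∣n⇒∣m+n (Signed.∣ᵤ⇒∣ {k} {m} k∣m) (Signed.∣ᵤ⇒∣ {k} {n} k∣n))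

∣n⇒∣m*n : ∀ k m n → k ℤ.∣ n → k ℤ.∣ m ℤ.* n
∣n⇒∣m*n k m n k∣n = Signed.∣⇒∣ᵤ {k} {m ℤ.* n} (Signed.∣n⇒∣m*n m (Signed.∣ᵤ⇒∣ {k} {n} k∣n))

∣m⇒∣m*n : ∀ k m n → k ℤ.∣ m → k ℤ.∣ m ℤ.* n
∣m⇒∣m*n k m n k∣m = Signed.∣⇒∣ᵤ {k} {m ℤ.* n} (Signed.∣m⇒∣m*n n (Signed.∣ᵤ⇒∣ {k} {m} k∣m))

∣m⇒∣-m : ∀ k m → k ℤ.∣ m → k ℤ.∣ - m
∣m⇒∣-m k m k∣m = Signed.∣⇒∣ᵤ {k} { - m} (Signed.∣m⇒∣-m (Signed.∣ᵤ⇒∣ {k} {m} k∣m))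

I : Mat
I = mat 1ℤ 0ℤ 0ℤ 1ℤ

adj : Mat → Mat
adj M = mat (d M) (- b M) (- c M) (a M)

mat-cong : ∀ {a₁ b₁ c₁ d₁ a₂ b₂ c₂ d₂} →
           a₁ ≡ a₂ → b₁ ≡ b₂ → c₁ ≡ c₂ → d₁ ≡ d₂ → mat a₁ b₁ c₁ d₁ ≡ mat a₂ b₂ c₂ d₂
mat-cong refl refl refl refl = refl

·-assoc : ∀ M N P → (M · N) · P ≡ M · (N · P)
·-assoc (mat a₁ b₁ c₁ d₁) (mat a₂ b₂ c₂ d₂) (mat a₃ b₃ c₃ d₃) =
  mat-cong (entry a₁ b₁ a₂ b₂ c₂ d₂ a₃ c₃) (entry a₁ b₁ a₂ b₂ c₂ d₂ b₃ d₃)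
           (entry c₁ d₁ a₂ b₂ c₂ d₂ a₃ c₃) (entry c₁ d₁ a₂ b₂ c₂ d₂ b₃ d₃)
  where
  entry : ∀ x y a₂ b₂ c₂ d₂ u v →
    (x ℤ.* a₂ ℤ.+ y ℤ.* c₂) ℤ.* u ℤ.+ (x ℤ.* b₂ ℤ.+ y ℤ.* d₂) ℤ.* v ≡
    x ℤ.* (a₂ ℤ.* u ℤ.+ b₂ ℤ.* v) ℤ.+ y ℤ.* (c₂ ℤ.* u ℤ.+ d₂ ℤ.* v)
  entry = solve-∀

·-identityˡ : ∀ M → I · M ≡ M
·-identityˡ (mat a₁ b₁ c₁ d₁) = mat-cong (top a₁ c₁) (top b₁ d₁) (bottom a₁ c₁) (bottom b₁ d₁)
  where
  top : ∀ x y → 1ℤ ℤ.* x ℤ.+ 0ℤ ℤ.* y ≡ x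
  top = solve-∀
  bottom : ∀ x y → 0ℤ ℤ.* x ℤ.+ 1ℤ ℤ.* y ≡ y
  bottom = solve-∀

·-identityʳ : ∀ M → M · I ≡ M
·-identityʳ (mat a₁ b₁ c₁ d₁) = mat-cong (left a₁ b₁) (right a₁ b₁) (left c₁ d₁) (right c₁ d₁)
  where
  left : ∀ x y → x ℤ.* 1ℤ ℤ.+ y ℤ.* 0ℤ ≡ x
  left = solve-∀
  right : ∀ x y → x ℤ.* 0ℤ ℤ.+ y ℤ.* 1ℤ ≡ y
  right = solve-∀

det-· : ∀ M N → det (M · N) ≡ det M ℤ.* det N
det-· (mat a₁ b₁ c₁ d₁) (mat a₂ b₂ c₂ d₂) = cauchy-binet a₁ b₁ c₁ d₁ a₂ b₂ c₂ d₂
  where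
  cauchy-binet : ∀ a₁ b₁ c₁ d₁ a₂ b₂ c₂ d₂ →
    (a₁ ℤ.* a₂ ℤ.+ b₁ ℤ.* c₂) ℤ.* (c₁ ℤ.* b₂ ℤ.+ d₁ ℤ.* d₂) ℤ.-
    (a₁ ℤ.* b₂ ℤ.+ b₁ ℤ.* d₂) ℤ.* (c₁ ℤ.* a₂ ℤ.+ d₁ ℤ.* c₂)
    ≡ (a₁ ℤ.* d₁ ℤ.- b₁ ℤ.* c₁) ℤ.* (a₂ ℤ.* d₂ ℤ.- b₂ ℤ.* c₂)
  cauchy-binet = solve-∀

det-adj : ∀ M → det (adj M) ≡ det M
det-adj (mat a₁ b₁ c₁ d₁) = expand a₁ b₁ c₁ d₁
  where
  expand : ∀ a₁ b₁ c₁ d₁ → d₁ ℤ.* a₁ ℤ.- (- b₁) ℤ.* (- c₁) ≡ a₁ ℤ.* d₁ ℤ.- b₁ ℤ.* c₁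
  expand = solve-∀

adj-inverseˡ : ∀ M → SL2 M → adj M · M ≡ I
adj-inverseˡ (mat a₁ b₁ c₁ d₁) det≡1 =
  mat-cong (trans (diag₁ a₁ b₁ c₁ d₁) det≡1) (upper b₁ d₁) (lower c₁ a₁) (trans (diag₂ a₁ b₁ c₁ d₁) det≡1)
  where
  diag₁ : ∀ a₁ b₁ c₁ d₁ → d₁ ℤ.* a₁ ℤ.+ (- b₁) ℤ.* c₁ ≡ a₁ ℤ.* d₁ ℤ.- b₁ ℤ.* c₁
  diag₁ = solve-∀
  diag₂ : ∀ a₁ b₁ c₁ d₁ → (- c₁) ℤ.* b₁ ℤ.+ a₁ ℤ.* d₁ ≡ a₁ ℤ.* d₁ ℤ.- b₁ ℤ.* c₁
  diag₂ = solve-∀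
  upper : ∀ x y → y ℤ.* x ℤ.+ (- x) ℤ.* y ≡ 0ℤ
  upper = solve-∀
  lower : ∀ x y → (- x) ℤ.* y ℤ.+ y ℤ.* x ≡ 0ℤ
  lower = solve-∀

adj-inverseʳ : ∀ M → SL2 M → M · adj M ≡ I
adj-inverseʳ (mat a₁ b₁ c₁ d₁) det≡1 =
  mat-cong (trans (diag₁ a₁ b₁ c₁ d₁) det≡1) (upper a₁ b₁) (lower c₁ d₁) (trans (diag₂ a₁ b₁ c₁ d₁) det≡1)
  where
  diag₁ : ∀ a₁ b₁ c₁ d₁ → a₁ ℤ.* d₁ ℤ.+ b₁ ℤ.* (- c₁) ≡ a₁ ℤ.* d₁ ℤ.- b₁ ℤ.* c₁
  diag₁ = solve-∀
  diag₂ : ∀ a₁ b₁ c₁ d₁ → c₁ ℤ.* (- b₁) ℤ.+ d₁ ℤ.* a₁ ≡ a₁ ℤ.* d₁ ℤ.- b₁ ℤ.* c₁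
  diag₂ = solve-∀
  upper : ∀ x y → x ℤ.* (- y) ℤ.+ y ℤ.* x ≡ 0ℤ
  upper = solve-∀
  lower : ∀ x y → x ℤ.* y ℤ.+ y ℤ.* (- x) ≡ 0ℤ
  lower = solve-∀

adj-cancelˡ : ∀ M N → SL2 M → adj M · (M · N) ≡ N
adj-cancelˡ M N det≡1 = begin
  adj M · (M · N)  ≡⟨ sym (·-assoc (adj M) M N) ⟩
  (adj M · M) · N  ≡⟨ cong (_· N) (adj-inverseˡ M det≡1) ⟩
  I · N            ≡⟨ ·-identityˡ N ⟩
  N                ∎
  where open ≡-Reasoning

adj-cancelʳ : ∀ M N → SL2 M → (N · M) · adj M ≡ N
adj-cancelʳ M N det≡1 = begin
  (N · M) · adj M  ≡⟨ ·-assoc N M (adj M) ⟩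
  N · (M · adj M)  ≡⟨ cong (N ·_) (adj-inverseʳ M det≡1) ⟩
  N · I            ≡⟨ ·-identityʳ N ⟩
  N                ∎
  where open ≡-Reasoning

SL2-· : ∀ M N → SL2 M → SL2 N → SL2 (M · N)
SL2-· M N det-M≡1 det-N≡1 = trans (det-· M N) (cong₂ ℤ._*_ det-M≡1 det-N≡1)

SL2-adj : ∀ M → SL2 M → SL2 (adj M)
SL2-adj M det≡1 = trans (det-adj M) det≡1

record IsSubgroup (H : Mat → Set) : Set where
  field
    ⊆SL2       : ∀ {M} → H M → SL2 M
    I∈         : H I
    ·-closed   : ∀ {M N} → H M → H N → H (M · N)
    adj-closed : ∀ {M} → H M → H (adj M)

SL2∩-isSubgroup : (P : Mat → Set) → P I →
                  (∀ M N → P M → P N → P (M · N)) → (∀ M → P M → P (adj M)) →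
                  IsSubgroup (λ M → SL2 M × P M)
SL2∩-isSubgroup P P-I P-· P-adj = record
  { ⊆SL2       = λ (M∈SL2 , _) → M∈SL2
  ; I∈         = refl , P-I
  ; ·-closed   = λ {M} {N} (M∈SL2 , P-M) (N∈SL2 , P-N) → SL2-· M N M∈SL2 N∈SL2 , P-· M N P-M P-N
  ; adj-closed = λ {M} (M∈SL2 , P-M) → SL2-adj M M∈SL2 , P-adj M P-M
  }

Γ⁰ : ℕ → Mat → Set
Γ⁰ p M = SL2 M × (+ p) ℤ.∣ b M

Γ₀-isSubgroup : ∀ N → IsSubgroup (Γ₀ N)
Γ₀-isSubgroup N = SL2∩-isSubgroup (λ M → (+ N) ℤ.∣ c M) (N ℕ.∣0)
  (λ M M′ N∣c-M N∣c-M′ → ∣m∣n⇒∣m+n (+ N) (c M ℤ.* a M′) (d M ℤ.* c M′)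
     (∣m⇒∣m*n (+ N) (c M) (a M′) N∣c-M) (∣n⇒∣m*n (+ N) (d M) (c M′) N∣c-M′))
  (λ M → ∣m⇒∣-m (+ N) (c M))

Γ⁰-isSubgroup : ∀ p → IsSubgroup (Γ⁰ p)
Γ⁰-isSubgroup p = SL2∩-isSubgroup (λ M → (+ p) ℤ.∣ b M) (p ℕ.∣0)
  (λ M M′ p∣b-M p∣b-M′ → ∣m∣n⇒∣m+n (+ p) (a M ℤ.* b M′) (b M ℤ.* d M′)
     (∣n⇒∣m*n (+ p) (a M) (b M′) p∣b-M′) (∣m⇒∣m*n (+ p) (b M) (d M′) p∣b-M))
  (λ M → ∣m⇒∣-m (+ p) (b M))

DisjointRightCosets : (H : Mat → Set) {J : Set} → (J → Mat) → Set
DisjointRightCosets H {J} R =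
  ∀ (j₁ j₂ : J) → j₁ ≢ j₂ → ∀ g → ¬ (InRightCoset H (R j₁) g × InRightCoset H (R j₂) g)

RightCosetsCover : (H G : Mat → Set) {J : Set} → (J → Mat) → Set
RightCosetsCover H G {J} R = ∀ g → G g → Σ J (λ j → InRightCoset H (R j) g)

InRightCoset-connect : ∀ {H} → IsSubgroup H → ∀ {R₁ R₂ g} →
                       InRightCoset H R₁ g → InRightCoset H R₂ g → InRightCoset H R₁ R₂
InRightCoset-connect H-grp {R₁} {R₂} {g} (h₁ , h₁∈H , g≡h₁R₁) (h₂ , h₂∈H , g≡h₂R₂) =
  adj h₂ · h₁ , ·-closed (adj-closed h₂∈H) h₁∈H , R₂≡h₂⁻¹h₁R₁
  where
  open IsSubgroup H-grp
  open ≡-Reasoning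
  R₂≡h₂⁻¹h₁R₁ : R₂ ≡ (adj h₂ · h₁) · R₁
  R₂≡h₂⁻¹h₁R₁ = begin
    R₂                 ≡⟨ sym (adj-cancelˡ h₂ R₂ (⊆SL2 h₂∈H)) ⟩
    adj h₂ · (h₂ · R₂) ≡⟨ cong (adj h₂ ·_) (trans (sym g≡h₂R₂) g≡h₁R₁) ⟩
    adj h₂ · (h₁ · R₁) ≡⟨ sym (·-assoc (adj h₂) h₁ R₁) ⟩
    (adj h₂ · h₁) · R₁ ∎

InRightCoset-restrict : ∀ {H K L R₁ R₂} → IsSubgroup K → (∀ M → H M → K M → L M) →
                        K R₁ → K R₂ → InRightCoset H R₁ R₂ → InRightCoset L R₁ R₂
InRightCoset-restrict {K = K} {R₁ = R₁} {R₂} K-grp H∩K⊆L R₁∈K R₂∈K (h , h∈H , R₂≡hR₁) =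
  h , H∩K⊆L h h∈H h∈K , R₂≡hR₁
  where
  open IsSubgroup K-grp
  open ≡-Reasoning
  h≡R₂R₁⁻¹ : h ≡ R₂ · adj R₁
  h≡R₂R₁⁻¹ = begin
    h                    ≡⟨ sym (adj-cancelʳ R₁ h (⊆SL2 R₁∈K)) ⟩
    (h · R₁) · adj R₁    ≡⟨ cong (_· adj R₁) (sym R₂≡hR₁) ⟩
    R₂ · adj R₁          ∎
  h∈K : K h
  h∈K = subst K (sym h≡R₂R₁⁻¹) (·-closed R₂∈K (adj-closed R₁∈K))

disjointRightCosets-lift : ∀ {H K L J} {R : J → Mat} →
  IsSubgroup H → IsSubgroup K → (∀ M → H M → K M → L M) →
  (∀ j → K (R j)) → DisjointRightCosets L R → DisjointRightCosets H R
disjointRightCosets-lift {R = R} H-grp K-grp H∩K⊆L R∈K L-disjoint j₁ j₂ j₁≢j₂ g (g∈HR₁ , g∈HR₂) =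
  L-disjoint j₁ j₂ j₁≢j₂ (R j₂)
    ( InRightCoset-restrict K-grp H∩K⊆L (R∈K j₁) (R∈K j₂) (InRightCoset-connect H-grp g∈HR₁ g∈HR₂)
    , (I , H∩K⊆L I (IsSubgroup.I∈ H-grp) (IsSubgroup.I∈ K-grp) , sym (·-identityˡ (R j₂))))

InRightCoset-cancelˡ : ∀ {H L R t g} → IsSubgroup H → (∀ M → L M → H M) →
                       H t → InRightCoset L R (t · g) → InRightCoset H R g
InRightCoset-cancelˡ {R = R} {t} {g} H-grp L⊆H t∈H (h , h∈L , tg≡hR) =
  adj t · h , ·-closed (adj-closed t∈H) (L⊆H h h∈L) , g≡t⁻¹hR
  where
  open IsSubgroup H-grp
  open ≡-Reasoning
  g≡t⁻¹hR : g ≡ (adj t · h) · R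
  g≡t⁻¹hR = begin
    g                 ≡⟨ sym (adj-cancelˡ t g (⊆SL2 t∈H)) ⟩
    adj t · (t · g)   ≡⟨ cong (adj t ·_) tg≡hR ⟩
    adj t · (h · R)   ≡⟨ sym (·-assoc (adj t) h R) ⟩
    (adj t · h) · R   ∎

rightCosetsCover-lift : ∀ {H L G G′ J} {R : J → Mat} →
  IsSubgroup H → (∀ M → L M → H M) → (∀ {g} → G g → Σ Mat (λ t → H t × G′ (t · g))) →
  RightCosetsCover L G′ R → RightCosetsCover H G R
rightCosetsCover-lift H-grp L⊆H G⊆H·G′ L-cover g g∈G =
  let t , t∈H , tg∈G′ = G⊆H·G′ g∈G
      j , tg∈LRⱼ      = L-cover (t · g) tg∈G′
  in  j , InRightCoset-cancelˡ H-grp L⊆H t∈H tg∈LRⱼ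

shear : ℤ → Mat
shear x = mat 1ℤ x 0ℤ 1ℤ

shear∈Γ₀ : ∀ N x → Γ₀ N (shear x)
shear∈Γ₀ N x = det≡1 x , N ℕ.∣0
  where
  det≡1 : ∀ x → 1ℤ ℤ.* 1ℤ ℤ.- x ℤ.* 0ℤ ≡ 1ℤ
  det≡1 = solve-∀

shear·∈Γ₀[,] : ∀ {n p} g → p ∣ n → Γ₀ n g → Γ₀[ n , p ] (shear (- (a g ℤ.* b g)) · g)
shear·∈Γ₀[,] {n} {p} g p∣n g∈Γ₀ =
  let tg∈SL2 , n∣c-tg = IsSubgroup.·-closed (Γ₀-isSubgroup n) {shear (- (a g ℤ.* b g))} {g}
                          (shear∈Γ₀ n (- (a g ℤ.* b g))) g∈Γ₀
  in  tg∈SL2 , n∣c-tg , subst ((+ p) ℤ.∣_) (sym b-tg≡-b²c) p∣b²c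
  where
  open ≡-Reasoning
  b-tg≡-b²c : b (shear (- (a g ℤ.* b g)) · g) ≡ - (b g ℤ.* b g) ℤ.* c g
  b-tg≡-b²c = begin
    1ℤ ℤ.* b g ℤ.+ - (a g ℤ.* b g) ℤ.* d g     ≡⟨ factor (a g) (b g) (d g) ⟩
    b g ℤ.* (1ℤ ℤ.- a g ℤ.* d g)              ≡⟨ cong (λ δ → b g ℤ.* (δ ℤ.- a g ℤ.* d g)) (sym (proj₁ g∈Γ₀)) ⟩
    b g ℤ.* (det g ℤ.- a g ℤ.* d g)           ≡⟨ cancel (a g) (b g) (c g) (d g) ⟩
    - (b g ℤ.* b g) ℤ.* c g                   ∎
    where
    factor : ∀ a b d → 1ℤ ℤ.* b ℤ.+ - (a ℤ.* b) ℤ.* d ≡ b ℤ.* (1ℤ ℤ.- a ℤ.* d)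
    factor = solve-∀
    cancel : ∀ a b c d → b ℤ.* ((a ℤ.* d ℤ.- b ℤ.* c) ℤ.- a ℤ.* d) ≡ - (b ℤ.* b) ℤ.* c
    cancel = solve-∀
  p∣b²c : (+ p) ℤ.∣ - (b g ℤ.* b g) ℤ.* c g
  p∣b²c = ∣n⇒∣m*n (+ p) (- (b g ℤ.* b g)) (c g) (ℕ.∣-trans p∣n (proj₂ g∈Γ₀))

Γ₀[,]⊆Γ₀ : ∀ N p M → Γ₀[ N , p ] M → Γ₀ N M
Γ₀[,]⊆Γ₀ _ _ _ (M∈SL2 , N∣c , _) = M∈SL2 , N∣c

Γ₀[,]⊆Γ⁰ : ∀ N p M → Γ₀[ N , p ] M → Γ⁰ p M
Γ₀[,]⊆Γ⁰ _ _ _ (M∈SL2 , _ , p∣b) = M∈SL2 , p∣b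

Γ₀∩Γ⁰⊆Γ₀[,] : ∀ N p M → Γ₀ N M → Γ⁰ p M → Γ₀[ N , p ] M
Γ₀∩Γ⁰⊆Γ₀[,] _ _ _ (M∈SL2 , N∣c) (_ , p∣b) = M∈SL2 , N∣c , p∣b

Γ₀-disjointRightCosets : ∀ N p {J} {R : J → Mat} → (∀ j → Γ⁰ p (R j)) →
                         DisjointRightCosets Γ₀[ N , p ] R → DisjointRightCosets (Γ₀ N) R
Γ₀-disjointRightCosets N p =
  disjointRightCosets-lift (Γ₀-isSubgroup N) (Γ⁰-isSubgroup p) (Γ₀∩Γ⁰⊆Γ₀[,] N p)

Γ₀-rightCosetsCover : ∀ M {n} p {J} {R : J → Mat} → p ∣ n →
                      RightCosetsCover Γ₀[ M , p ] Γ₀[ n , p ] R → RightCosetsCover (Γ₀ M) (Γ₀ n) R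
Γ₀-rightCosetsCover M p p∣n =
  rightCosetsCover-lift (Γ₀-isSubgroup M) (Γ₀[,]⊆Γ₀ M p)
    (λ {g} g∈Γ₀ → shear (- (a g ℤ.* b g)) , shear∈Γ₀ M (- (a g ℤ.* b g)) , shear·∈Γ₀[,] g p∣n g∈Γ₀)

lemma3p3 :
    ((p m n : ℕ) → .{{_ : NonZero p}} → .{{_ : NonZero m}} → .{{_ : NonZero n}} →
      (J : Set) (R : J → Mat) →
      IsRightCosetReps Γ₀[ n * m , p ] Γ₀[ n , p ] J R →
      ∀ j₁ j₂ → j₁ ≢ j₂ → ∀ g →
      ¬ (InRightCoset (Γ₀ (n * m)) (R j₁) g × InRightCoset (Γ₀ (n * m)) (R j₂) g))
    ×
    ((p n e : ℕ) → .{{_ : NonZero n}} → Prime p → p ∣ n →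
      (J : Set) (R : J → Mat) →
      IsRightCosetReps Γ₀[ p ^ e * n , p ] Γ₀[ n , p ] J R →
      IsRightCosetReps (Γ₀ (p ^ e * n)) (Γ₀ n) J R)
lemma3p3 =
    (λ p m n J R (R∈ , _ , disjoint) →
        Γ₀-disjointRightCosets (n * m) p (λ j → Γ₀[,]⊆Γ⁰ n p (R j) (R∈ j)) disjoint)
  , (λ p n e _ p∣n J R (R∈ , cover , disjoint) →
        (λ j → Γ₀[,]⊆Γ₀ n p (R j) (R∈ j))
      , Γ₀-rightCosetsCover (p ^ e * n) p p∣n cover
      , Γ₀-disjointRightCosets (p ^ e * n) p (λ j → Γ₀[,]⊆Γ⁰ n p (R j) (R∈ j)) disjoint)
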